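{- For every $n$-vertex graph $G$ with vertices $s,t$ and every positive integer $k$, the diameter of $k\text{ -SPR}(G,s,t)$ is at most $2^n$.
   Context: All graphs are finite, simple, undirected, unweighted. For a positive integer $k$, a $k$-SPR reconfiguration step transforms an $s$–$t$ shortest path into another $s$–$t$ shortest path by replacing at most $k$ contiguous vertices by new vertices. The reconfiguration graph $k\text{ -SPR}(G,s,t)$ has one vertex for each $s$–$t$ shortest path in $G$, two being adjacent iff one can be obtained from the other by a single $k$-SPR reconfiguration step. -}

module Defs where

open import Level using (0ℓ)
open import Data.Nat using (ℕ; zero; suc; _≤_)
open import Data.Fin using (Fin)
open import Data.List using (List; []; _∷_; _++_; length)
open import Data.Product using (Σ; ∃; _×_)
open import Relation.Nullary using (¬_)
open import Relation.Binary.PropositionalEquality using (_≡_)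

record Graph (n : ℕ) : Set₁ where
  field
    Adj     : Fin n → Fin n → Set
    symm    : ∀ {u v} → Adj u v → Adj v u
    irrefl  : ∀ {u} → ¬ Adj u u

module _ {n : ℕ} (G : Graph n) where
  open Graph G

  data Walk : Fin n → List (Fin n) → Fin n → Set where
    stop : ∀ {u} → Walk u (u ∷ []) u
    step : ∀ {u v w xs} → Adj u v → Walk v xs w → Walk u (u ∷ xs) w

  -- P is an s–t shortest path: an s–t walk with a minimum number of vertices
  -- among all s–t walks (such a walk is automatically a path).
  IsShortestPath : Fin n → Fin n → List (Fin n) → Set
  IsShortestPath s t P =
    Walk s P t × (∀ Q → Walk s Q t → length P ≤ length Q)

  SPRStep : ℕ → Fin n → Fin n → List (Fin n) → List (Fin n) → Set
  SPRStep k s t P Q =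
    IsShortestPath s t P × IsShortestPath s t Q ×
    Σ (List (Fin n)) λ A → Σ (List (Fin n)) λ B →
    Σ (List (Fin n)) λ B′ → Σ (List (Fin n)) λ C →
      (P ≡ A ++ B ++ C) × (Q ≡ A ++ B′ ++ C) ×
      (length B ≤ k) × (length B′ ≡ length B)

  -- ReachIn k s t m P Q : Q is reachable from P by at most m k-SPR steps,
  -- i.e. dist(P,Q) ≤ m in k-SPR(G,s,t) (P itself a shortest path).
  data ReachIn (k : ℕ) (s t : Fin n) : ℕ → List (Fin n) → List (Fin n) → Set where
    done : ∀ {m P} → IsShortestPath s t P → ReachIn k s t m P P
    more : ∀ {m P Q R} → SPRStep k s t P Q → ReachIn k s t m Q R →
           ReachIn k s t (suc m) P R

  Connected : ℕ → Fin n → Fin n → List (Fin n) → List (Fin n) → Set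
  Connected k s t P Q = ∃ λ m → ReachIn k s t m P Q

{-# OPTIONS --safe #-}
module Submission where

open import Defs
open import Data.Nat using (ℕ; zero; suc; _+_; _∸_; _≤_; _<_; _^_; _≤?_; z≤n; s≤s; s≤s⁻¹; pred)
open import Data.Nat.Properties
  using (≤-antisym; m≤n+m; m≤n⇒m≤1+n; +-cancelʳ-≤; +-cancelˡ-≡; +-monoˡ-<; m+[n∸m]≡n; ≰⇒>)
open import Data.Fin using (Fin; zero; suc; toℕ; funToFin; finToFun)
open import Data.Fin.Patterns using (0F; 1F)
open import Data.Fin.Properties using (finToFun-funToFin; pigeonhole; toℕ≤pred[n])
import Data.Fin.Properties as Fin
open import Data.List using (List; []; _∷_; _++_; [_]; length)
open import Data.List.Properties using (length-++; ++-assoc; ∷-injectiveʳ)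
open import Data.List.Membership.Propositional using (_∈_)
open import Data.List.Membership.Propositional.Properties using (∈-∃++; ∈-++⁺ʳ)
open import Data.List.Relation.Binary.Subset.Propositional using (_⊆_)
open import Data.List.Relation.Unary.Any using (here)
open import Data.Product using (_,_)
open import Relation.Nullary using (Dec; yes; no; contradiction)
open import Relation.Binary.PropositionalEquality using (_≡_; refl; sym; trans; cong; subst; subst₂; module ≡-Reasoning)

-- In a shortest s–t path every vertex v sits at position d(s, v), so a shortest
-- path is determined by its vertex set and k-SPR(G, s, t) has at most 2^n
-- vertices. A reconfiguration sequence of more than 2^n steps therefore visits
-- some path twice, and cutting out the loop shortens it.

indicator : ∀ {a} {A : Set a} → Dec A → Fin 2
indicator (yes _) = 1F
indicator (no _)  = 0F

indicator-transport : ∀ {a b} {A : Set a} {B : Set b} (a? : Dec A) (b? : Dec B) →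
                      indicator a? ≡ indicator b? → A → B
indicator-transport _        (yes b) _  _ = b
indicator-transport (no ¬a)  (no _)  _  a = contradiction a ¬a
indicator-transport (yes _)  (no _)  ()

m<n≤o⇒m+[o∸n]<o : ∀ {m n o} → m < n → n ≤ o → m + (o ∸ n) < o
m<n≤o⇒m+[o∸n]<o {m} {n} {o} m<n n≤o =
  subst (m + (o ∸ n) <_) (m+[n∸m]≡n n≤o) (+-monoˡ-< (o ∸ n) m<n)

++-cancelˡ-length : ∀ {a} {A : Set a} (ws xs : List A) {ys zs : List A} →
                    length ws ≡ length xs → ws ++ ys ≡ xs ++ zs → ys ≡ zs
++-cancelˡ-length []       []       _  eq = eq
++-cancelˡ-length (_ ∷ ws) (_ ∷ xs) le eq =
  ++-cancelˡ-length ws xs (cong pred le) (∷-injectiveʳ eq)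

module _ {n : ℕ} (G : Graph n) where

  open import Data.List.Membership.DecPropositional (Fin._≟_ {n}) using (_∈?_)

  -- The list index of a walk is only seen to be non-empty after splitting off its
  -- head, hence the case split on A rather than on the walk.
  walk-suffix : ∀ (A : List (Fin n)) {s v B t} → Walk G s (A ++ v ∷ B) t → Walk G v (v ∷ B) t
  walk-suffix []          stop       = stop
  walk-suffix []          (step e w) = step e w
  walk-suffix (_ ∷ [])    (step _ w) = walk-suffix [] w
  walk-suffix (_ ∷ b ∷ A) (step _ w) = walk-suffix (b ∷ A) w

  walk-splice : ∀ (A : List (Fin n)) {A′ s s′ v B B′ t t′} →
                Walk G s (A ++ v ∷ B) t → Walk G s′ (A′ ++ v ∷ B′) t′ → Walk G s (A ++ v ∷ B′) t′
  walk-splice []          {A′} stop       w′ = walk-suffix A′ w′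
  walk-splice []          {A′} (step _ _) w′ = walk-suffix A′ w′
  walk-splice (_ ∷ [])    (step e w)      w′ = step e (walk-splice [] w w′)
  walk-splice (_ ∷ b ∷ A) (step e w)      w′ = step e (walk-splice (b ∷ A) w w′)

  module _ {s t : Fin n} where

    shortest-length-≡ : ∀ {P Q} → IsShortestPath G s t P → IsShortestPath G s t Q →
                        length P ≡ length Q
    shortest-length-≡ (wP , minP) (wQ , minQ) = ≤-antisym (minP _ wQ) (minQ _ wP)

    shortest-prefix-≤ : ∀ A A′ {v B B′} →
                        IsShortestPath G s t (A ++ v ∷ B) → IsShortestPath G s t (A′ ++ v ∷ B′) →
                        length A′ ≤ length A
    shortest-prefix-≤ A A′ {B′ = B′} (wP , _) (wQ , minQ) =
      +-cancelʳ-≤ (suc (length B′)) (length A′) (length A)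
        (subst₂ _≤_ (length-++ A′) (length-++ A) (minQ _ (walk-splice A wP wQ)))

    shortest-prefix-≡ : ∀ A A′ {v B B′} →
                        IsShortestPath G s t (A ++ v ∷ B) → IsShortestPath G s t (A′ ++ v ∷ B′) →
                        length A ≡ length A′
    shortest-prefix-≡ A A′ spP spQ =
      ≤-antisym (shortest-prefix-≤ A′ A spQ spP) (shortest-prefix-≤ A A′ spP spQ)

    shortest-path-⊆⇒≡ : ∀ {P Q} → IsShortestPath G s t P → IsShortestPath G s t Q → P ⊆ Q → P ≡ Q
    shortest-path-⊆⇒≡ {P} {Q} spP spQ P⊆Q = agree-after [] P Q refl refl
      where
      agree-after : ∀ C P₁ Q₁ → P ≡ C ++ P₁ → Q ≡ C ++ Q₁ → P₁ ≡ Q₁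
      agree-after C []       []       _  _  = refl
      agree-after C []       (q ∷ Q₁) eP eQ =
        contradiction (+-cancelˡ-≡ (length C) 0 (suc (length Q₁)) lengths) λ ()
        where
        open ≡-Reasoning
        lengths : length C + 0 ≡ length C + suc (length Q₁)
        lengths = begin
          length C + 0           ≡⟨ length-++ C ⟨
          length (C ++ [])       ≡⟨ cong length eP ⟨
          length P               ≡⟨ shortest-length-≡ spP spQ ⟩
          length Q               ≡⟨ cong length eQ ⟩
          length (C ++ q ∷ Q₁)   ≡⟨ length-++ C ⟩
          length C + suc (length Q₁) ∎
      agree-after C (v ∷ P₂) Q₁ eP eQ
        with A′ , B′ , eQ′ ← ∈-∃++ (P⊆Q (subst (v ∈_) (sym eP) (∈-++⁺ʳ C (here refl)))) =
        trans (cong (v ∷_) rest) (sym Q₁≡v∷B′)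
        where
        Q₁≡v∷B′ : Q₁ ≡ v ∷ B′
        Q₁≡v∷B′ = ++-cancelˡ-length C A′
          (shortest-prefix-≡ C A′ (subst (IsShortestPath G s t) eP spP)
                                  (subst (IsShortestPath G s t) eQ′ spQ))
          (trans (sym eQ) eQ′)
        rest : P₂ ≡ B′
        rest = agree-after (C ++ [ v ]) P₂ B′
          (trans eP (sym (++-assoc C [ v ] P₂)))
          (trans eQ (trans (cong (C ++_) Q₁≡v∷B′) (sym (++-assoc C [ v ] B′))))

  vertexSet : List (Fin n) → Fin (2 ^ n)
  vertexSet P = funToFin (λ v → indicator (v ∈? P))

  vertexSet-⊆ : ∀ {P Q} → vertexSet P ≡ vertexSet Q → P ⊆ Q
  vertexSet-⊆ {P} {Q} eq {v} = indicator-transport (v ∈? P) (v ∈? Q) same-indicator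
    where
    open ≡-Reasoning
    same-indicator : indicator (v ∈? P) ≡ indicator (v ∈? Q)
    same-indicator = begin
      indicator (v ∈? P)            ≡⟨ finToFun-funToFin _ v ⟨
      finToFun (vertexSet P) v      ≡⟨ cong (λ c → finToFun c v) eq ⟩
      finToFun (vertexSet Q) v      ≡⟨ finToFun-funToFin _ v ⟩
      indicator (v ∈? Q)            ∎

  shortest-path-vertexSet-injective : ∀ {s t P Q} →
    IsShortestPath G s t P → IsShortestPath G s t Q → vertexSet P ≡ vertexSet Q → P ≡ Q
  shortest-path-vertexSet-injective spP spQ eq = shortest-path-⊆⇒≡ spP spQ (vertexSet-⊆ eq)

  module _ (k : ℕ) (s t : Fin n) where

    ReachIn-source : ∀ {m P Q} → ReachIn G k s t m P Q → IsShortestPath G s t P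
    ReachIn-source (done spP)         = spP
    ReachIn-source (more (spP , _) _) = spP

    ReachIn-mono : ∀ {m m′ P Q} → m ≤ m′ → ReachIn G k s t m P Q → ReachIn G k s t m′ P Q
    ReachIn-mono _          (done spP) = done spP
    ReachIn-mono (s≤s m≤m′) (more x r) = more x (ReachIn-mono m≤m′ r)

    ReachIn-trans : ∀ {a b P X Q} → ReachIn G k s t a P X → ReachIn G k s t b X Q →
                    ReachIn G k s t (a + b) P Q
    ReachIn-trans {a} {b} (done _)   r′ = ReachIn-mono (m≤n+m b a) r′
    ReachIn-trans         (more x r) r′ = more x (ReachIn-trans r r′)

    -- Sequences ending early (with done) are padded by repeating their last path.
    ReachIn-path : ∀ {m P Q} → ReachIn G k s t m P Q → Fin (suc m) → List (Fin n)
    ReachIn-path {P = P} (done _)   _       = P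
    ReachIn-path {P = P} (more _ _) zero    = P
    ReachIn-path         (more _ r) (suc i) = ReachIn-path r i

    ReachIn-to-path : ∀ {m P Q} (r : ReachIn G k s t m P Q) i →
                      ReachIn G k s t (toℕ i) P (ReachIn-path r i)
    ReachIn-to-path (done spP)          _       = done spP
    ReachIn-to-path (more (spP , _) _) zero    = done spP
    ReachIn-to-path (more x r)          (suc i) = more x (ReachIn-to-path r i)

    ReachIn-from-path : ∀ {m P Q} (r : ReachIn G k s t m P Q) i →
                        ReachIn G k s t (m ∸ toℕ i) (ReachIn-path r i) Q
    ReachIn-from-path (done spP) _       = done spP
    ReachIn-from-path (more x r) zero    = more x r
    ReachIn-from-path (more x r) (suc i) = ReachIn-from-path r i

    ReachIn-shorten : ∀ {m P Q} → 2 ^ n ≤ m → ReachIn G k s t (suc m) P Q → ReachIn G k s t m P Q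
    ReachIn-shorten {m} {Q = Q} 2ⁿ≤m r
      with i , j , i<j , same-set ← pigeonhole (s≤s (m≤n⇒m≤1+n 2ⁿ≤m)) (λ i → vertexSet (ReachIn-path r i)) =
      ReachIn-mono (s≤s⁻¹ (m<n≤o⇒m+[o∸n]<o i<j (toℕ≤pred[n] j)))
        (ReachIn-trans (ReachIn-to-path r i)
          (subst (λ X → ReachIn G k s t _ X Q) (sym repeated) (ReachIn-from-path r j)))
      where
      repeated : ReachIn-path r i ≡ ReachIn-path r j
      repeated = shortest-path-vertexSet-injective
        (ReachIn-source (ReachIn-from-path r i)) (ReachIn-source (ReachIn-from-path r j)) same-set

    ReachIn-bounded : ∀ m {P Q} → ReachIn G k s t m P Q → ReachIn G k s t (2 ^ n) P Q
    ReachIn-bounded zero    r = ReachIn-mono z≤n r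
    ReachIn-bounded (suc m) r with suc m ≤? 2 ^ n
    ... | yes m+1≤2ⁿ = ReachIn-mono m+1≤2ⁿ r
    ... | no  m+1≰2ⁿ = ReachIn-bounded m (ReachIn-shorten (s≤s⁻¹ (≰⇒> m+1≰2ⁿ)) r)

-- The bound holds for k = 0 as well.
mainTheorem16 : (n : ℕ) (G : Graph n) (s t : Fin n) (k : ℕ) → 1 ≤ k →
                (P Q : List (Fin n)) → Connected G k s t P Q →
                ReachIn G k s t (2 ^ n) P Q
mainTheorem16 n G s t k _ P Q (m , r) = ReachIn-bounded G k s t m r
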